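{- Let $\pi=(v_1,\dots,v_n)$ be a maximal arrangement of a digraph $D$. Then $l(v_1)\ge l(v_2)\ge\cdots\ge l(v_n)$, i.e., the vertices are arranged by level in non-increasing order.
   Context: An arrangement of an $n$-vertex digraph $D$ is a bijection $\pi:V(D)\to\{1,\dots,n\}$, written $\pi=(v_1,\dots,v_n)$ when $\pi(v_i)=i$. For $1\le i\le n-1$, $c_i$ is the number of edges with tail in $\{v_1,\dots,v_i\}$ and head in $\{v_{i+1},\dots,v_n\}$; set $c_0=c_n=0$. The level of $v_i$ is $l(v_i)=c_i-c_{i-1}$. The signature of $\pi$ is $(c_1,\dots,c_{n-1})$; signatures of arrangements of $D$ are partially ordered componentwise, and $\pi$ is maximal if its signature is a maximal element of the set of signatures of all arrangements of $D$. -}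

module Defs where

open import Data.Bool using (Bool; true; false; if_then_else_; _∧_; not)
open import Data.Nat using (ℕ; suc; _≤_; _<_; _<ᵇ_)
open import Data.Integer using (ℤ; +_; _-_)
open import Data.Fin using (Fin; toℕ)
open import Data.List using (map; allFin)
open import Data.Nat.ListAction using (sum)
open import Data.Fin.Permutation using (Permutation′; _⟨$⟩ʳ_; _⟨$⟩ˡ_)
open import Data.Product using (Σ; _×_)
open import Relation.Nullary using (¬_)
open import Relation.Binary.PropositionalEquality using (_≡_)

-- A digraph on vertex set Fin n, given by its adjacency relation:
-- adj u w ≡ true  iff  (u , w) is an edge (tail u, head w).
record Digraph (n : ℕ) : Set where
  field
    adj : Fin n → Fin n → Bool
    loopless : ∀ v → adj v v ≡ false
open Digraph public

-- An arrangement π : V(D) → {1..n} is a bijection; we use positions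
-- 0..n-1 (Fin n), so the vertex at 0-based position k is v_{k+1}.
Arrangement : ℕ → Set
Arrangement n = Permutation′ n

pos : ∀ {n} → Arrangement n → Fin n → ℕ
pos π v = toℕ (π ⟨$⟩ʳ v)

-- c i = number of edges with tail among the first i vertices
-- (v_1..v_i) and head among the rest (v_{i+1}..v_n).
-- Note c 0 = 0 and c n = 0 automatically.
cut : ∀ {n} → Digraph n → Arrangement n → ℕ → ℕ
cut {n} D π i =
  sum (map (λ u → sum (map (λ w →
    if adj D u w ∧ (pos π u <ᵇ i) ∧ not (pos π w <ᵇ i) then 1 else 0)
    (allFin n))) (allFin n))

-- level of a vertex: l(v_k) = c_k - c_{k-1}, where v is at 0-based position k-1
level : ∀ {n} → Digraph n → Arrangement n → Fin n → ℤ
level D π v = + cut D π (suc (pos π v)) - + cut D π (pos π v)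

vertexAt : ∀ {n} → Arrangement n → Fin n → Fin n
vertexAt π k = π ⟨$⟩ˡ k

SigLeq : ∀ {n} → Digraph n → Arrangement n → Arrangement n → Set
SigLeq {n} D π π' = ∀ i → 1 ≤ i → i < n → cut D π i ≤ cut D π' i

SigLt : ∀ {n} → Digraph n → Arrangement n → Arrangement n → Set
SigLt {n} D π π' = SigLeq D π π' ×
  Σ ℕ (λ i → 1 ≤ i × i < n × ¬ (cut D π i ≡ cut D π' i))

Maximal : ∀ {n} → Digraph n → Arrangement n → Set
Maximal {n} D π = ∀ (π' : Arrangement n) → ¬ SigLt D π π'

module Submission where

open import Defs
open import Data.Nat using (ℕ; _≤_)
open import Data.Fin using (Fin; toℕ)
open import Data.Integer using () renaming (_≤_ to _≤ℤ_)

open import Data.Fin using (fromℕ<; _≟_)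
open import Data.Bool using (Bool; true; false; if_then_else_; _∧_; _∨_; not)
open import Data.Bool.Properties using (∧-idem; ∨-idem)
open import Data.Nat using (zero; suc; _+_; _<_; _<ᵇ_; z≤n; s≤s; _≤′_; ≤′-refl; ≤′-step)
import Data.Nat.Properties as ℕ
open import Data.Nat.ListAction using (sum)
open import Data.Integer using (ℤ; +_; _-_; _⊖_)
import Data.Integer.Properties as ℤ
open import Data.Fin.Properties using (toℕ-injective; toℕ-fromℕ<; toℕ<n)
open import Data.Fin.Permutation using (_⟨$⟩ʳ_; _∘ₚ_; transpose; inverseʳ)
import Data.Fin.Permutation.Components as Components
open import Data.List using (List; []; _∷_; map; allFin)
open import Data.List.Properties using (map-cong)
open import Data.Product using (_,_)
open import Function using (_∘_; flip)
open import Relation.Nullary using (yes; no; contradiction)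
open import Relation.Binary.PropositionalEquality
open import Algebra.Properties.CommutativeSemigroup ℕ.+-commutativeSemigroup using (interchange)

-- Swapping the adjacent vertices v_{k+1}, v_{k+2} changes only c_{k+1}.  The
-- prefix sets {v_1..v_k} and {v_1..v_{k+2}} are the meet and join of the
-- prefix {v_1..v_{k+1}} before and after the swap, so submodularity of the
-- directed cut function gives c_k + c_{k+2} ≤ c_{k+1} + c'_{k+1}.  If the
-- levels increased at k+1, i.e. c_k + c_{k+2} > 2 c_{k+1}, the swapped
-- arrangement would have a strictly larger signature.  Hence at a maximal
-- arrangement the levels are non-increasing step by step, so everywhere.

<ᵇ-irrefl : ∀ n → (n <ᵇ n) ≡ false
<ᵇ-irrefl zero    = refl
<ᵇ-irrefl (suc n) = <ᵇ-irrefl n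

n<ᵇ1+n : ∀ n → (n <ᵇ suc n) ≡ true
n<ᵇ1+n zero    = refl
n<ᵇ1+n (suc n) = n<ᵇ1+n n

m≢n⇒m<ᵇ1+n≡m<ᵇn : ∀ {m n} → m ≢ n → (m <ᵇ suc n) ≡ (m <ᵇ n)
m≢n⇒m<ᵇ1+n≡m<ᵇn {zero}  {zero}  0≢0 = contradiction refl 0≢0
m≢n⇒m<ᵇ1+n≡m<ᵇn {zero}  {suc n} _   = refl
m≢n⇒m<ᵇ1+n≡m<ᵇn {suc m} {zero}  _   = refl
m≢n⇒m<ᵇ1+n≡m<ᵇn {suc m} {suc n} m≢n = m≢n⇒m<ᵇ1+n≡m<ᵇn (m≢n ∘ cong suc)

n≢1+m⇒1+m<ᵇn≡m<ᵇn : ∀ {m n} → n ≢ suc m → (suc m <ᵇ n) ≡ (m <ᵇ n)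
n≢1+m⇒1+m<ᵇn≡m<ᵇn {m} {zero}  _     = refl
n≢1+m⇒1+m<ᵇn≡m<ᵇn {m} {suc n} n≢1+m = sym (m≢n⇒m<ᵇ1+n≡m<ᵇn (n≢1+m ∘ cong suc ∘ sym))

data SwapsAt (k : ℕ) : ℕ → ℕ → Set where
  left  : SwapsAt k k (suc k)
  right : SwapsAt k (suc k) k
  fixed : ∀ {a} → a ≢ k → a ≢ suc k → SwapsAt k a a

SwapsAt-<ᵇ-stable : ∀ {k a b i} → SwapsAt k a b → i ≢ suc k → (b <ᵇ i) ≡ (a <ᵇ i)
SwapsAt-<ᵇ-stable left        i≢1+k = n≢1+m⇒1+m<ᵇn≡m<ᵇn i≢1+k
SwapsAt-<ᵇ-stable right       i≢1+k = sym (n≢1+m⇒1+m<ᵇn≡m<ᵇn i≢1+k)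
SwapsAt-<ᵇ-stable (fixed _ _) _     = refl

SwapsAt-<ᵇ-∧ : ∀ {k a b} → SwapsAt k a b → (a <ᵇ k) ≡ (a <ᵇ suc k) ∧ (b <ᵇ suc k)
SwapsAt-<ᵇ-∧ {k} left rewrite <ᵇ-irrefl k | n<ᵇ1+n k = refl
SwapsAt-<ᵇ-∧ {k} right rewrite <ᵇ-irrefl k =
  trans (n≢1+m⇒1+m<ᵇn≡m<ᵇn (ℕ.1+n≢n {k} ∘ sym)) (<ᵇ-irrefl k)
SwapsAt-<ᵇ-∧ {k} {a} (fixed a≢k _) =
  sym (trans (∧-idem (a <ᵇ suc k)) (m≢n⇒m<ᵇ1+n≡m<ᵇn a≢k))

SwapsAt-<ᵇ-∨ : ∀ {k a b} → SwapsAt k a b → (a <ᵇ suc (suc k)) ≡ (a <ᵇ suc k) ∨ (b <ᵇ suc k)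
SwapsAt-<ᵇ-∨ {k} left rewrite n<ᵇ1+n k =
  trans (m≢n⇒m<ᵇ1+n≡m<ᵇn (ℕ.1+n≢n {k} ∘ sym)) (n<ᵇ1+n k)
SwapsAt-<ᵇ-∨ {k} right rewrite <ᵇ-irrefl k | n<ᵇ1+n k = refl
SwapsAt-<ᵇ-∨ {k} {a} (fixed _ a≢1+k) =
  trans (m≢n⇒m<ᵇ1+n≡m<ᵇn a≢1+k) (sym (∨-idem (a <ᵇ suc k)))

transpose-SwapsAt : ∀ {n k} (i j : Fin n) → toℕ i ≡ k → toℕ j ≡ suc k →
                    ∀ x → SwapsAt k (toℕ x) (toℕ (Components.transpose i j x))
transpose-SwapsAt i j refl j≡1+i x with x ≟ i
... | yes refl = subst (SwapsAt _ _) (sym j≡1+i) left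
... | no x≢i with x ≟ j
...   | yes refl = subst (λ a → SwapsAt _ a _) (sym j≡1+i) right
...   | no x≢j   = fixed (x≢i ∘ toℕ-injective) (x≢j ∘ toℕ-injective ∘ flip trans (sym j≡1+i))

sum-map-+-mono-≤ : ∀ {A : Set} (xs : List A) {f g h k : A → ℕ} →
                   (∀ x → f x + g x ≤ h x + k x) →
                   sum (map f xs) + sum (map g xs) ≤ sum (map h xs) + sum (map k xs)
sum-map-+-mono-≤ []       _  = z≤n
sum-map-+-mono-≤ (x ∷ xs) {f} {g} {h} {k} le = begin
  (f x + F) + (g x + G) ≡⟨ interchange (f x) F (g x) G ⟩
  (f x + g x) + (F + G) ≤⟨ ℕ.+-mono-≤ (le x) (sum-map-+-mono-≤ xs le) ⟩
  (h x + k x) + (H + K) ≡⟨ interchange (h x) (k x) H K ⟩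
  (h x + H) + (k x + K) ∎
  where
  open ℕ.≤-Reasoning
  F = sum (map f xs)
  G = sum (map g xs)
  H = sum (map h xs)
  K = sum (map k xs)

prefix : ∀ {n} → Arrangement n → ℕ → Fin n → Bool
prefix π i v = pos π v <ᵇ i

crossing : Bool → Bool → Bool → ℕ
crossing e s t = if e ∧ s ∧ not t then 1 else 0

-- cut D π i is definitionally cutOf D (prefix π i).
cutOf : ∀ {n} → Digraph n → (Fin n → Bool) → ℕ
cutOf {n} D S = sum (map (λ u → sum (map (λ w → crossing (adj D u w) (S u) (S w)) (allFin n))) (allFin n))

cutOf-cong : ∀ {n} (D : Digraph n) {S T : Fin n → Bool} → (∀ v → S v ≡ T v) → cutOf D S ≡ cutOf D T
cutOf-cong {n} D S≗T = cong sum (map-cong (λ u → cong sum (map-cong (λ w →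
  cong₂ (crossing (adj D u w)) (S≗T u) (S≗T w)) (allFin n))) (allFin n))

crossing-submodular : ∀ e a b a′ b′ →
  crossing e (a ∧ b) (a′ ∧ b′) + crossing e (a ∨ b) (a′ ∨ b′) ≤ crossing e a a′ + crossing e b b′
crossing-submodular false _     _     _     _     = z≤n
crossing-submodular true  false false false false = ℕ.≤ᵇ⇒≤ _ _ _
crossing-submodular true  false false false true  = ℕ.≤ᵇ⇒≤ _ _ _
crossing-submodular true  false false true  false = ℕ.≤ᵇ⇒≤ _ _ _
crossing-submodular true  false false true  true  = ℕ.≤ᵇ⇒≤ _ _ _
crossing-submodular true  false true  false false = ℕ.≤ᵇ⇒≤ _ _ _
crossing-submodular true  false true  false true  = ℕ.≤ᵇ⇒≤ _ _ _
crossing-submodular true  false true  true  false = ℕ.≤ᵇ⇒≤ _ _ _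
crossing-submodular true  false true  true  true  = ℕ.≤ᵇ⇒≤ _ _ _
crossing-submodular true  true  false false false = ℕ.≤ᵇ⇒≤ _ _ _
crossing-submodular true  true  false false true  = ℕ.≤ᵇ⇒≤ _ _ _
crossing-submodular true  true  false true  false = ℕ.≤ᵇ⇒≤ _ _ _
crossing-submodular true  true  false true  true  = ℕ.≤ᵇ⇒≤ _ _ _
crossing-submodular true  true  true  false false = ℕ.≤ᵇ⇒≤ _ _ _
crossing-submodular true  true  true  false true  = ℕ.≤ᵇ⇒≤ _ _ _
crossing-submodular true  true  true  true  false = ℕ.≤ᵇ⇒≤ _ _ _
crossing-submodular true  true  true  true  true  = ℕ.≤ᵇ⇒≤ _ _ _

cutOf-submodular : ∀ {n} (D : Digraph n) (S T : Fin n → Bool) →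
  cutOf D (λ v → S v ∧ T v) + cutOf D (λ v → S v ∨ T v) ≤ cutOf D S + cutOf D T
cutOf-submodular {n} D S T =
  sum-map-+-mono-≤ (allFin n) λ u → sum-map-+-mono-≤ (allFin n) λ w →
    crossing-submodular (adj D u w) (S u) (T u) (S w) (T w)

swapAt : ∀ {n k} → Arrangement n → suc k < n → Arrangement n
swapAt π 1+k<n = π ∘ₚ transpose (fromℕ< (ℕ.<⇒≤ 1+k<n)) (fromℕ< 1+k<n)

pos-swapAt : ∀ {n k} (π : Arrangement n) (1+k<n : suc k < n) v →
             SwapsAt k (pos π v) (pos (swapAt π 1+k<n) v)
pos-swapAt π 1+k<n v =
  transpose-SwapsAt _ _ (toℕ-fromℕ< (ℕ.<⇒≤ 1+k<n)) (toℕ-fromℕ< 1+k<n) (π ⟨$⟩ʳ v)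

cut-swapAt-≢ : ∀ {n k} (D : Digraph n) π (1+k<n : suc k < n) {i} → i ≢ suc k →
               cut D (swapAt π 1+k<n) i ≡ cut D π i
cut-swapAt-≢ D π 1+k<n i≢1+k =
  cutOf-cong D λ v → SwapsAt-<ᵇ-stable (pos-swapAt π 1+k<n v) i≢1+k

cut-swapAt-submodular : ∀ {n k} (D : Digraph n) π (1+k<n : suc k < n) →
  cut D π k + cut D π (suc (suc k)) ≤ cut D π (suc k) + cut D (swapAt π 1+k<n) (suc k)
cut-swapAt-submodular {k = k} D π 1+k<n = begin
  cut D π k + cut D π (suc (suc k))
    ≡⟨ cong₂ _+_ (cutOf-cong D λ v → SwapsAt-<ᵇ-∧ (pos-swapAt π 1+k<n v))
                 (cutOf-cong D λ v → SwapsAt-<ᵇ-∨ (pos-swapAt π 1+k<n v)) ⟩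
  cutOf D (λ v → S v ∧ T v) + cutOf D (λ v → S v ∨ T v)
    ≤⟨ cutOf-submodular D S T ⟩
  cutOf D S + cutOf D T ∎
  where
  open ℕ.≤-Reasoning
  S = prefix π (suc k)
  T = prefix (swapAt π 1+k<n) (suc k)

maximal⇒cut-concave : ∀ {n} (D : Digraph n) π → Maximal D π → ∀ {k} → suc k < n →
  cut D π k + cut D π (suc (suc k)) ≤ cut D π (suc k) + cut D π (suc k)
maximal⇒cut-concave D π maximal {k} 1+k<n = ℕ.≮⇒≥ λ convex →
  maximal π′ (signature-< (ℕ.+-cancelˡ-< (cut D π (suc k)) _ _
    (ℕ.<-≤-trans convex (cut-swapAt-submodular D π 1+k<n))))
  where
  π′ = swapAt π 1+k<n
  signature-< : cut D π (suc k) < cut D π′ (suc k) → SigLt D π π′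
  signature-< c<c′ = signature-≤ , suc k , s≤s z≤n , 1+k<n , ℕ.<⇒≢ c<c′
    where
    signature-≤ : SigLeq D π π′
    signature-≤ i _ _ with i ℕ.≟ suc k
    ... | yes refl = ℕ.<⇒≤ c<c′
    ... | no i≢1+k = ℕ.≤-reflexive (sym (cut-swapAt-≢ D π 1+k<n i≢1+k))

p+m≤n+o⇒[+m]-[+n]≤[+o]-[+p] : ∀ {m n o p} → p + m ≤ n + o → + m - + n ≤ℤ + o - + p
p+m≤n+o⇒[+m]-[+n]≤[+o]-[+p] {m} {n} {o} {p} p+m≤n+o = begin
  + m - + n             ≡⟨ ℤ.[+m]-[+n]≡m⊖n m n ⟩
  m ⊖ n                 ≡⟨ sym (ℤ.+-cancelˡ-⊖ p m n) ⟩
  (p + m) ⊖ (p + n)     ≤⟨ ℤ.⊖-monoˡ-≤ (p + n) p+m≤n+o ⟩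
  (n + o) ⊖ (p + n)     ≡⟨ cong ((n + o) ⊖_) (ℕ.+-comm p n) ⟩
  (n + o) ⊖ (n + p)     ≡⟨ ℤ.+-cancelˡ-⊖ n o p ⟩
  o ⊖ p                 ≡⟨ sym (ℤ.[+m]-[+n]≡m⊖n o p) ⟩
  + o - + p             ∎
  where open ℤ.≤-Reasoning

stepwise-antitone : ∀ {n} (f : ℕ → ℤ) → (∀ {k} → suc k < n → f (suc k) ≤ℤ f k) →
                    ∀ {i j} → i ≤′ j → j < n → f j ≤ℤ f i
stepwise-antitone f step ≤′-refl       _     = ℤ.≤-refl
stepwise-antitone f step (≤′-step i≤j) 1+j<n =
  ℤ.≤-trans (step 1+j<n) (stepwise-antitone f step i≤j (ℕ.<⇒≤ 1+j<n))

levelAt : ∀ {n} → Digraph n → Arrangement n → ℕ → ℤ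
levelAt D π k = + cut D π (suc k) - + cut D π k

level-vertexAt : ∀ {n} (D : Digraph n) π (j : Fin n) → level D π (vertexAt π j) ≡ levelAt D π (toℕ j)
level-vertexAt D π j = cong (levelAt D π ∘ toℕ) (inverseʳ π)

maximal⇒levelAt-step : ∀ {n} (D : Digraph n) π → Maximal D π → ∀ {k} → suc k < n →
                       levelAt D π (suc k) ≤ℤ levelAt D π k
maximal⇒levelAt-step D π maximal {k} 1+k<n =
  p+m≤n+o⇒[+m]-[+n]≤[+o]-[+p] {cut D π (suc (suc k))} {cut D π (suc k)}
    (maximal⇒cut-concave D π maximal 1+k<n)

mainTheorem10 : ∀ {n : ℕ} (D : Digraph n) (π : Arrangement n) → Maximal D π → ∀ (i j : Fin n) → toℕ i ≤ toℕ j → level D π (vertexAt π j) ≤ℤ level D π (vertexAt π i)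
mainTheorem10 D π maximal i j i≤j =
  subst₂ _≤ℤ_ (sym (level-vertexAt D π j)) (sym (level-vertexAt D π i))
    (stepwise-antitone (levelAt D π) (maximal⇒levelAt-step D π maximal) (ℕ.≤⇒≤′ i≤j) (toℕ<n j))
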